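{- For every integer $n\ge 3$, $$c_2(n,K_5^-)=\left\lfloor\frac{2n-2}{3}\right\rfloor.$$
   Context: A $3$-graph $H=(V,E)$ consists of a finite vertex set $V$ and an edge set $E\subseteq\binom{V}{3}$. For distinct $a,b\in V$, the codegree $d_H(a,b)$ is the number of vertices $c$ with $\{a,b,c\}\in E$, and the minimum codegree $\delta_2(H)$ is the minimum of $d_H(a,b)$ over all pairs of distinct vertices. For $3$-graphs $F$ and $H$, an $F$-covering of $H$ is a collection of copies of $F$ in $H$ such that every vertex of $H$ lies in at least one of them. Define $c_2(n,F)$ as the maximum of $\delta_2(H)$ over all $3$-graphs $H$ on $n$ vertices having no $F$-covering. $K_5^-$ denotes the complete $3$-graph on $5$ vertices with one edge removed. -}

module Defs where

open import Data.Nat using (ℕ; zero; suc; _+_; _⊓_; _≡ᵇ_; _≤ᵇ_; _/_)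
open import Data.Bool using (Bool; true; false; not; _∧_; if_then_else_)
open import Data.Fin using (Fin; toℕ)
open import Data.Fin.Properties using (all?)
open import Data.Nat.ListAction using (sum)
open import Data.List using (List; []; _∷_; map; foldr; concatMap; allFin)
open import Data.Product using (Σ; Σ-syntax; _×_; _,_)
open import Relation.Binary.PropositionalEquality using (_≡_; _≢_; refl)
open import Relation.Nullary using (¬_)
open import Relation.Nullary.Decidable using (toWitness)
open import Data.Bool.Properties using (_≟_)
open import Function.Definitions using (Injective)

-- Edges are given by a Boolean predicate on
-- ordered triples which is required to be invariant under permutations of the
-- triple and false whenever two entries coincide; it therefore encodes exactly
-- a set of 3-element subsets of Fin n.
record ThreeGraph (n : ℕ) : Set where
  field
    edge    : Fin n → Fin n → Fin n → Bool
    sym₁₂   : ∀ a b c → edge a b c ≡ edge b a c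
    sym₂₃   : ∀ a b c → edge a b c ≡ edge a c b
    loopless : ∀ a c → edge a a c ≡ false
open ThreeGraph public

codeg : ∀ {n} → ThreeGraph n → Fin n → Fin n → ℕ
codeg {n} H a b = sum (map (λ c → if edge H a b c then 1 else 0) (allFin n))

distinctPairs : (n : ℕ) → List (Fin n × Fin n)
distinctPairs n =
  concatMap (λ a → concatMap (λ b → if toℕ a ≡ᵇ toℕ b then [] else (a , b) ∷ [])
                                (allFin n))
            (allFin n)

-- minimum codegree δ₂(H): minimum of d_H(a,b) over pairs of distinct vertices.
-- (The fold starts at n, which exceeds every codegree, so for n ≥ 2 this is
-- exactly the minimum.)
δ₂ : ∀ {n} → ThreeGraph n → ℕ
δ₂ {n} H = foldr (λ p m → codeg H (Data.Product.proj₁ p) (Data.Product.proj₂ p) ⊓ m) n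
                 (distinctPairs n)

record Copy {k n : ℕ} (F : ThreeGraph k) (H : ThreeGraph n) : Set where
  field
    φ     : Fin k → Fin n
    inj   : Injective _≡_ _≡_ φ
    edges : ∀ a b c → edge F a b c ≡ true → edge H (φ a) (φ b) (φ c) ≡ true
open Copy public

HasCovering : ∀ {k n} → ThreeGraph k → ThreeGraph n → Set
HasCovering {k} {n} F H = ∀ (v : Fin n) → Σ[ C ∈ Copy F H ] Σ[ i ∈ Fin k ] φ C i ≡ v

IsC₂ : ∀ {k} → (n : ℕ) → ThreeGraph k → ℕ → Set
IsC₂ {k} n F m =
  (Σ[ H ∈ ThreeGraph n ] (¬ HasCovering F H × δ₂ H ≡ m)) ×
  (∀ (H : ThreeGraph n) → ¬ HasCovering F H → δ₂ H Data.Nat.≤ m)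

private
  big : Fin 5 → Bool
  big x = 2 ≤ᵇ toℕ x

  neq : Fin 5 → Fin 5 → Bool
  neq x y = not (toℕ x ≡ᵇ toℕ y)

K5e : Fin 5 → Fin 5 → Fin 5 → Bool
K5e a b c = neq a b ∧ neq b c ∧ neq a c ∧ not (big a ∧ big b ∧ big c)

K5⁻ : ThreeGraph 5
K5⁻ = record
  { edge = K5e
  ; sym₁₂ = λ a b c → toWitness {a? = all? λ a → all? λ b → all? λ c → K5e a b c ≟ K5e b a c} _ a b c
  ; sym₂₃ = λ a b c → toWitness {a? = all? λ a → all? λ b → all? λ c → K5e a b c ≟ K5e a c b} _ a b c
  ; loopless = λ a c → toWitness {a? = all? λ a → all? λ c → K5e a a c ≟ false} _ a c
  }

module Submission where

-- Upper bound: if δ₂(H) > ⌊(2n−2)/3⌋ then 3δ₂(H) ≥ 2n − 1, and double counting codegrees extends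
-- every pair of vertices to an edge, every edge to a K₄, and every K₄ to a K₅⁻ through a vertex
-- lying in the links of at least five of its six pairs; so every vertex lies in a copy of K₅⁻.
-- Lower bound: put a special vertex 0 aside, split the other vertices into three parts of size at
-- most M = n − 1 − ⌊(2n−2)/3⌋ and give them coordinates in ℤ_M. The edges are the triples avoiding 0
-- that meet at most two parts, the triples meeting all three parts with coordinates summing to 0 in
-- ℤ_M, and the triples 0xy with x, y in different parts. The link of 0 is 3-partite, which forces two
-- vertices of any K₅⁻ through 0 into one part with equal coordinates; and every pair of vertices
-- misses at most M + 1 vertices, so δ₂ = ⌊(2n−2)/3⌋.

open import Defs
open import Data.Nat using (ℕ; _≤_; _*_; _∸_; _/_)

open import Data.Bool using (Bool; true; false; if_then_else_; T; not; _∧_)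
open import Data.Bool.Properties using () renaming (_≟_ to _≟ᵇ_)
open import Data.Fin using (Fin; zero; suc; toℕ; #_; fromℕ<; splitAt; punchIn; punchOut)
open import Data.Fin.Properties
  using (_≟_; all?; any?; toℕ-injective; toℕ<n; toℕ-fromℕ<; punchInᵢ≢i; punchIn-punchOut)
open import Data.List as List using (List; foldr; tabulate; concatMap; allFin)
open import Data.List.Membership.Propositional using (_∈_; find; lose)
open import Data.List.Membership.Propositional.Properties using (∈-concatMap⁺; ∈-concatMap⁻; ∈-allFin)
open import Data.List.Properties using (map-tabulate)
open import Data.List.Relation.Unary.Any using (here; there)
open import Data.Nat using (zero; suc; _+_; _<_; _⊓_; _%_; _≡ᵇ_; z≤n; s≤s; _<?_; _≤?_; NonZero)
open import Data.Nat.DivMod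
open import Data.Nat.ListAction using () renaming (sum to sumᴸ)
open import Data.Nat.Properties hiding (_≟_)
open import Data.Nat.Properties using () renaming (_≟_ to _≟ℕ_)
open import Algebra.Properties.CommutativeMonoid.Sum +-0-commutativeMonoid
  using (sum-syntax; sum-cong-≗; ∑-distrib-+; ∑-comm)
open import Algebra.Properties.CommutativeSemigroup +-commutativeSemigroup using (xy∙z≈xz∙y)
open import Data.Nat.Tactic.RingSolver using (solve-∀)
open import Data.Product as Prod using (_×_; _,_; proj₁; proj₂; ∃; ∃₂)
open import Data.Product.Properties using (≡-dec)
open import Data.Sum as Sum using (_⊎_; inj₁; inj₂; [_,_]′)
open import Data.Vec.Functional using (Vector; []; _∷_; _++_; removeAt)
open import Function using (_∘_; id)
open import Function.Bundles using (mk⇔)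
open import Function.Definitions using (Injective)
open import Relation.Binary using (DecidableEquality)
open import Relation.Binary.PropositionalEquality
open import Relation.Nullary
  using (Dec; does; yes; no; ¬_; ¬?; _→-dec_; _×-dec_; _⊎-dec_; contradiction; from-yes)
open import Relation.Nullary.Decidable using (dec-true; dec-false; does-⇔)

bit : Bool → ℕ
bit b = if b then 1 else 0

bit≤1 : ∀ b → bit b ≤ 1
bit≤1 true  = ≤-refl
bit≤1 false = z≤n

bit-positive : ∀ {b} → 0 < bit b → b ≡ true
bit-positive {true} _ = refl

bit-T : ∀ {b} → T b → bit b ≡ 1
bit-T {true} _ = refl

does-true : ∀ {A : Set} (a? : Dec A) → does a? ≡ true → A
does-true (yes a) _ = a

∑-mono-≤ : ∀ {n} {f g : Fin n → ℕ} → (∀ i → f i ≤ g i) → ∑[ i < n ] f i ≤ ∑[ i < n ] g i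
∑-mono-≤ {zero}  f≤g = z≤n
∑-mono-≤ {suc n} f≤g = +-mono-≤ (f≤g zero) (∑-mono-≤ (f≤g ∘ suc))

∑-const : ∀ n k → ∑[ i < n ] k ≡ n * k
∑-const zero    k = refl
∑-const (suc n) k = cong (k +_) (∑-const n k)

∑-zero : ∀ n → ∑[ i < n ] 0 ≡ 0
∑-zero n = trans (∑-const n 0) (*-zeroʳ n)

∑-bits≤ : ∀ {n} (b : Fin n → Bool) → ∑[ i < n ] bit (b i) ≤ n
∑-bits≤ {n} b = ≤-trans (∑-mono-≤ (bit≤1 ∘ b)) (≤-reflexive (trans (∑-const n 1) (*-identityʳ n)))

term≤∑ : ∀ {n} (f : Fin n → ℕ) i → f i ≤ ∑[ j < n ] f j
term≤∑ f zero    = m≤m+n _ _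
term≤∑ f (suc i) = ≤-trans (term≤∑ (f ∘ suc) i) (m≤n+m _ _)

∑-pigeonhole : ∀ {n} k (f : Fin n → ℕ) → n * k < ∑[ i < n ] f i → ∃ λ i → k < f i
∑-pigeonhole {n} k f n*k<∑ with any? (λ i → k <? f i)
... | yes found = found
... | no none   = contradiction n*k<∑ (≤⇒≯ (begin
  ∑[ i < n ] f i  ≤⟨ ∑-mono-≤ (λ i → ≮⇒≥ (none ∘ (i ,_))) ⟩
  ∑[ i < n ] k    ≡⟨ ∑-const n k ⟩
  n * k           ∎))
  where open ≤-Reasoning

all-true : ∀ {n} (b : Fin n → Bool) → n ≤ ∑[ i < n ] bit (b i) → ∀ i → b i ≡ true
all-true {suc n} b full i with b zero in b₀
... | false = contradiction full (<⇒≱ (s≤s (∑-bits≤ (b ∘ suc))))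
all-true {suc n} b full zero    | true = b₀
all-true {suc n} b full (suc i) | true = all-true (b ∘ suc) (≤-pred full) i

all-but-one-true : ∀ {n} (b : Fin (suc n) → Bool) → n ≤ ∑[ i < suc n ] bit (b i) →
                   ∃ λ j → ∀ i → i ≢ j → b i ≡ true
all-but-one-true {n} b most with b zero in b₀
... | false = zero , λ { zero 0≢0 → contradiction refl 0≢0 ; (suc i) _ → all-true (b ∘ suc) most i }
all-but-one-true {zero} b most | true = zero , λ { zero 0≢0 → contradiction refl 0≢0 }
all-but-one-true {suc n} b most | true with all-but-one-true (b ∘ suc) (≤-pred most)
... | j , rest = suc j , λ { zero _ → b₀ ; (suc i) i≢j → rest i (i≢j ∘ cong suc) }

∑-indicator : ∀ {n} (x : Fin n) → ∑[ c < n ] bit (does (c ≟ x)) ≡ 1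
∑-indicator {suc n} zero    = cong suc (∑-zero n)
∑-indicator {suc n} (suc x) = ∑-indicator {n} x

count-≡ᵇ≤1 : ∀ n x → ∑[ c < n ] bit (toℕ c ≡ᵇ x) ≤ 1
count-≡ᵇ≤1 zero    x       = z≤n
count-≡ᵇ≤1 (suc n) zero    = ≤-reflexive (cong suc (∑-zero n))
count-≡ᵇ≤1 (suc n) (suc x) = count-≡ᵇ≤1 n x

count-above : ∀ n k (b : ℕ → Bool) → (∀ c → c < k → b c ≡ false) → ∑[ c < n ] bit (b (toℕ c)) ≤ n ∸ k
count-above zero    k       b low = z≤n
count-above (suc n) zero    b low = ∑-bits≤ (b ∘ toℕ)
count-above (suc n) (suc k) b low rewrite low 0 (s≤s z≤n) =
  count-above n k (b ∘ suc) (λ c c<k → low (suc c) (s≤s c<k))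

sum-tabulate : ∀ {n} (f : Fin n → ℕ) → sumᴸ (tabulate f) ≡ ∑[ i < n ] f i
sum-tabulate {zero}  f = refl
sum-tabulate {suc n} f = cong (f zero +_) (sum-tabulate (f ∘ suc))

codeg-∑ : ∀ {n} (H : ThreeGraph n) a b → codeg H a b ≡ ∑[ c < n ] bit (edge H a b c)
codeg-∑ H a b = trans (cong sumᴸ (map-tabulate id (bit ∘ edge H a b))) (sum-tabulate (bit ∘ edge H a b))

module _ {A : Set} (f : A → ℕ) where

  foldr-⊓≤ : ∀ z {xs x} → x ∈ xs → foldr (λ p m → f p ⊓ m) z xs ≤ f x
  foldr-⊓≤ z (here refl)     = m⊓n≤m _ _
  foldr-⊓≤ z (there x∈xs) = ≤-trans (m⊓n≤n _ _) (foldr-⊓≤ z x∈xs)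

  ≤-foldr-⊓ : ∀ {k z} xs → k ≤ z → (∀ {x} → x ∈ xs → k ≤ f x) → k ≤ foldr (λ p m → f p ⊓ m) z xs
  ≤-foldr-⊓ List.[]       k≤z k≤f = k≤z
  ≤-foldr-⊓ (x List.∷ xs) k≤z k≤f = ⊓-glb (k≤f (here refl)) (≤-foldr-⊓ xs k≤z (k≤f ∘ there))

private
  pairIf : ∀ {n} → Fin n → Fin n → List (Fin n × Fin n)
  pairIf a b = if toℕ a ≡ᵇ toℕ b then List.[] else List.[ a , b ]

  ∈-pairIf⁺ : ∀ {n} {a b : Fin n} → a ≢ b → (a , b) ∈ pairIf a b
  ∈-pairIf⁺ {a = a} {b} a≢b with toℕ a ≡ᵇ toℕ b in eq
  ... | true  = contradiction (toℕ-injective (≡ᵇ⇒≡ (toℕ a) (toℕ b) (subst T (sym eq) _))) a≢b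
  ... | false = here refl

  ∈-pairIf⁻ : ∀ {n} {a b x y : Fin n} → (x , y) ∈ pairIf a b → x ≢ y
  ∈-pairIf⁻ {a = a} {b} x,y∈ with toℕ a ≡ᵇ toℕ b in eq
  ∈-pairIf⁻ {a = a} {b} (here refl) | false = λ a≡b → subst T eq (≡⇒≡ᵇ (toℕ a) (toℕ b) (cong toℕ a≡b))

∈-distinctPairs⁺ : ∀ {n} {a b : Fin n} → a ≢ b → (a , b) ∈ distinctPairs n
∈-distinctPairs⁺ {n} {a} {b} a≢b =
  ∈-concatMap⁺ (λ a → concatMap (pairIf a) (allFin n)) {xs = allFin n}
    (lose (∈-allFin a) (∈-concatMap⁺ (pairIf a) {xs = allFin n} (lose (∈-allFin b) (∈-pairIf⁺ a≢b))))

∈-distinctPairs⁻ : ∀ {n} {x y : Fin n} → (x , y) ∈ distinctPairs n → x ≢ y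
∈-distinctPairs⁻ {n} x,y∈ with find (∈-concatMap⁻ (λ a → concatMap (pairIf a) (allFin n)) {xs = allFin n} x,y∈)
... | a , _ , x,y∈ₐ with find (∈-concatMap⁻ (pairIf a) {xs = allFin n} x,y∈ₐ)
...   | b , _ , x,y∈ₐ,ᵦ = ∈-pairIf⁻ x,y∈ₐ,ᵦ

codeg-≥ : ∀ {n k} (H : ThreeGraph n) {a b} (g : Fin k → ℕ) →
          (∀ c → edge H a b c ≡ true ⊎ ∃ λ i → toℕ c ≡ g i) → n ≤ codeg H a b + k
codeg-≥ {n} {k} H {a} {b} g covered = begin
  n
    ≡⟨ trans (∑-const n 1) (*-identityʳ n) ⟨
  ∑[ c < n ] 1
    ≤⟨ ∑-mono-≤ one≤ ⟩
  ∑[ c < n ] (bit (edge H a b c) + ∑[ i < k ] bit (toℕ c ≡ᵇ g i))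
    ≡⟨ ∑-distrib-+ (λ c → bit (edge H a b c)) (λ c → ∑[ i < k ] bit (toℕ c ≡ᵇ g i)) ⟩
  ∑[ c < n ] bit (edge H a b c) + ∑[ c < n ] ∑[ i < k ] bit (toℕ c ≡ᵇ g i)
    ≡⟨ cong₂ _+_ (codeg-∑ H a b) (∑-comm {k} {n} λ i c → bit (toℕ c ≡ᵇ g i)) ⟨
  codeg H a b + ∑[ i < k ] ∑[ c < n ] bit (toℕ c ≡ᵇ g i)
    ≤⟨ +-monoʳ-≤ (codeg H a b) (∑-mono-≤ λ i → count-≡ᵇ≤1 n (g i)) ⟩
  codeg H a b + ∑[ i < k ] 1
    ≡⟨ cong (codeg H a b +_) (trans (∑-const k 1) (*-identityʳ k)) ⟩
  codeg H a b + k ∎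
  where
  open ≤-Reasoning
  one≤ : ∀ c → 1 ≤ bit (edge H a b c) + ∑[ i < k ] bit (toℕ c ≡ᵇ g i)
  one≤ c with covered c
  ... | inj₁ e rewrite e = s≤s z≤n
  ... | inj₂ (i , c≡gi) = ≤-trans (≤-trans (≤-reflexive (sym (bit-T (≡⇒≡ᵇ _ _ c≡gi))))
                                           (term≤∑ (λ i → bit (toℕ c ≡ᵇ g i)) i))
                                  (m≤n+m _ _)

δ₂≤codeg : ∀ {n} (H : ThreeGraph n) {a b} → a ≢ b → δ₂ H ≤ codeg H a b
δ₂≤codeg H a≢b = foldr-⊓≤ (λ (x , y) → codeg H x y) _ (∈-distinctPairs⁺ a≢b)

≤δ₂ : ∀ {n} (H : ThreeGraph n) {k} → k ≤ n → (∀ a b → a ≢ b → k ≤ codeg H a b) → k ≤ δ₂ H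
≤δ₂ {n} H k≤n k≤codeg = ≤-foldr-⊓ (λ (x , y) → codeg H x y) (distinctPairs n) k≤n
  λ {(x , y)} x,y∈ → k≤codeg x y (∈-distinctPairs⁻ x,y∈)

record Symmetric₃ {A : Set} (P : A → A → A → Set) : Set where
  field
    swap₁₂ : ∀ {x y z} → P x y z → P y x z
    swap₂₃ : ∀ {x y z} → P x y z → P x z y

edge-symmetric : ∀ {n} (H : ThreeGraph n) → Symmetric₃ (λ a b c → edge H a b c ≡ true)
edge-symmetric H = record
  { swap₁₂ = λ {a} {b} {c} → trans (sym (sym₁₂ H a b c))
  ; swap₂₃ = λ {a} {b} {c} → trans (sym (sym₂₃ H a b c))
  }

module _ {A : Set} where

  Distinct : A → A → A → Set
  Distinct x y z = x ≢ y × y ≢ z × x ≢ z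

  distinct-symmetric : Symmetric₃ Distinct
  distinct-symmetric = record
    { swap₁₂ = λ (x≢y , y≢z , x≢z) → x≢y ∘ sym , x≢z , y≢z
    ; swap₂₃ = λ (x≢y , y≢z , x≢z) → x≢z , y≢z ∘ sym , x≢y
    }

  AnyOf : (A → Set) → A → A → A → Set
  AnyOf Q x y z = Q x ⊎ Q y ⊎ Q z

  anyOf-symmetric : ∀ {Q} → Symmetric₃ (AnyOf Q)
  anyOf-symmetric = record
    { swap₁₂ = [ inj₂ ∘ inj₁ , [ inj₁ , inj₂ ∘ inj₂ ]′ ]′
    ; swap₂₃ = [ inj₁ , [ inj₂ ∘ inj₂ , inj₂ ∘ inj₁ ]′ ]′
    }

  module _ {P Q : A → A → A → Set} (p : Symmetric₃ P) (q : Symmetric₃ Q) where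
    open Symmetric₃

    ×-symmetric : Symmetric₃ (λ x y z → P x y z × Q x y z)
    ×-symmetric = record
      { swap₁₂ = Prod.map (swap₁₂ p) (swap₁₂ q) ; swap₂₃ = Prod.map (swap₂₃ p) (swap₂₃ q) }

    ⊎-symmetric : Symmetric₃ (λ x y z → P x y z ⊎ Q x y z)
    ⊎-symmetric = record
      { swap₁₂ = Sum.map (swap₁₂ p) (swap₁₂ q) ; swap₂₃ = Sum.map (swap₂₃ p) (swap₂₃ q) }

  ¬-symmetric : ∀ {P : A → A → A → Set} → Symmetric₃ P → Symmetric₃ (λ x y z → ¬ P x y z)
  ¬-symmetric p = record { swap₁₂ = λ ¬p → ¬p ∘ swap₁₂ ; swap₂₃ = λ ¬p → ¬p ∘ swap₂₃ }
    where open Symmetric₃ p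

  ∘-symmetric : ∀ {B : Set} {P : A → A → A → Set} (f : B → A) → Symmetric₃ P →
                Symmetric₃ (λ x y z → P (f x) (f y) (f z))
  ∘-symmetric f p = record { swap₁₂ = swap₁₂ ; swap₂₃ = swap₂₃ }
    where open Symmetric₃ p

sum-symmetric : ∀ (Q : ℕ → Set) (f : ℕ → ℕ) → Symmetric₃ (λ x y z → Q (f x + f y + f z))
sum-symmetric Q f = record
  { swap₁₂ = λ {x} {y} {z} → subst Q (cong (_+ f z) (+-comm (f x) (f y)))
  ; swap₂₃ = λ {x} {y} {z} → subst Q (xy∙z≈xz∙y (f x) (f y) (f z))
  }

fromPredicate : ∀ {P : ℕ → ℕ → ℕ → Set} → (∀ x y z → Dec (P x y z)) → Symmetric₃ P →
                (∀ x z → ¬ P x x z) → (n : ℕ) → ThreeGraph n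
fromPredicate P? P-symmetric irreflexive n = record
  { edge     = λ a b c → does (P? (toℕ a) (toℕ b) (toℕ c))
  ; sym₁₂    = λ a b c → does-⇔ (mk⇔ swap₁₂ swap₁₂) (P? (toℕ a) (toℕ b) (toℕ c))
                                                     (P? (toℕ b) (toℕ a) (toℕ c))
  ; sym₂₃    = λ a b c → does-⇔ (mk⇔ swap₂₃ swap₂₃) (P? (toℕ a) (toℕ b) (toℕ c))
                                                     (P? (toℕ a) (toℕ c) (toℕ b))
  ; loopless = λ a c → dec-false (P? (toℕ a) (toℕ a) (toℕ c)) (irreflexive (toℕ a) (toℕ c))
  }
  where open Symmetric₃ P-symmetric

Triple : ℕ → Set
Triple k = Fin k × Fin k × Fin k

_≟₃_ : ∀ {k} → DecidableEquality (Triple k)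
_≟₃_ = ≡-dec _≟_ (≡-dec _≟_ _≟_)

permutations : ∀ {k} → Triple k → Vector (Triple k) 6
permutations (a , b , c) =
  (a , b , c) ∷ (b , a , c) ∷ (a , c , b) ∷ (b , c , a) ∷ (c , a , b) ∷ (c , b , a) ∷ []

Within : ∀ {k m} → Vector (Triple k) m → Triple k → Set
Within ts t = ∃₂ λ i σ → permutations (ts i) σ ≡ t

within? : ∀ {k m} (ts : Vector (Triple k) m) t → Dec (Within ts t)
within? ts t = any? λ i → any? λ σ → permutations (ts i) σ ≟₃ t

Spanning : ∀ {k m} → Vector (Triple k) m → Set
Spanning {k} ts = (a b : Fin k) → a ≢ b → ∃ λ c → Within ts (a , b , c)

spanning? : ∀ {k m} (ts : Vector (Triple k) m) → Dec (Spanning ts)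
spanning? ts = all? λ a → all? λ b → ¬? (a ≟ b) →-dec any? λ c → within? ts (a , b , c)

module _ {n} (H : ThreeGraph n) where

  open Symmetric₃ (edge-symmetric H)

  EdgeAt : ∀ {k} → (Fin k → Fin n) → Triple k → Set
  EdgeAt ψ (a , b , c) = edge H (ψ a) (ψ b) (ψ c) ≡ true

  Realizes : ∀ {k m} → (Fin k → Fin n) → Vector (Triple k) m → Set
  Realizes ψ ts = ∀ i → EdgeAt ψ (ts i)

  edgeAt-permutations : ∀ {k} (ψ : Fin k → Fin n) t σ → EdgeAt ψ t → EdgeAt ψ (permutations t σ)
  edgeAt-permutations ψ t zero                                e = e
  edgeAt-permutations ψ t (suc zero)                          e = swap₁₂ e
  edgeAt-permutations ψ t (suc (suc zero))                    e = swap₂₃ e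
  edgeAt-permutations ψ t (suc (suc (suc zero)))              e = swap₂₃ (swap₁₂ e)
  edgeAt-permutations ψ t (suc (suc (suc (suc zero))))        e = swap₁₂ (swap₂₃ e)
  edgeAt-permutations ψ t (suc (suc (suc (suc (suc zero))))) e = swap₁₂ (swap₂₃ (swap₁₂ e))

  edgeAt-within : ∀ {k m} {ψ : Fin k → Fin n} {ts : Vector (Triple k) m} {t} →
                  Realizes ψ ts → Within ts t → EdgeAt ψ t
  edgeAt-within {ψ = ψ} {ts} real (i , σ , refl) = edgeAt-permutations ψ (ts i) σ (real i)

  injective-if-joined : ∀ {k} (ψ : Fin k → Fin n) →
                        (∀ a b → a ≢ b → ∃ λ c → edge H (ψ a) (ψ b) (ψ c) ≡ true) →
                        Injective _≡_ _≡_ ψ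
  injective-if-joined ψ joined {a} {b} ψa≡ψb with a ≟ b
  ... | yes a≡b = a≡b
  ... | no  a≢b with joined a b a≢b
  ...   | c , e with () ← trans (sym (subst (λ x → edge H x (ψ b) (ψ c) ≡ true) ψa≡ψb e))
                                (loopless H (ψ b) (ψ c))

  realizes-injective : ∀ {k m} {ψ : Fin k → Fin n} {ts : Vector (Triple k) m} →
                       Realizes ψ ts → Spanning ts → Injective _≡_ _≡_ ψ
  realizes-injective {ψ = ψ} real spans = injective-if-joined ψ λ a b a≢b →
    let c , w = spans a b a≢b in c , edgeAt-within real w

  copy : ∀ {k} (F : ThreeGraph k) (φ : Fin k → Fin n) →
         (∀ a b → a ≢ b → ∃ λ c → edge F a b c ≡ true) →
         (∀ a b c → edge F a b c ≡ true → edge H (φ a) (φ b) (φ c) ≡ true) → Copy F H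
  copy F φ F-joined preserves = record
    { φ     = φ
    ; inj   = injective-if-joined φ λ a b a≢b →
                let c , e = F-joined a b a≢b in c , preserves a b c e
    ; edges = preserves
    }

-- Common neighbours of pairs

all-++ : ∀ {A : Set} {P : A → Set} {m k} {xs : Vector A m} {ys : Vector A k} →
         (∀ i → P (xs i)) → (∀ i → P (ys i)) → ∀ i → P ((xs ++ ys) i)
all-++ {m = m} all-xs all-ys i with splitAt m i
... | inj₁ i′ = all-xs i′
... | inj₂ i′ = all-ys i′

lift : ∀ {k m} → Vector (Triple k) m → Vector (Triple (suc k)) m
lift ts i = suc (proj₁ (ts i)) , suc (proj₁ (proj₂ (ts i))) , suc (proj₂ (proj₂ (ts i)))

cone : ∀ {s p} → Vector (Fin s × Fin s) p → Vector (Triple (suc s)) p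
cone pr i = suc (proj₁ (pr i)) , suc (proj₂ (pr i)) , zero

avoids : ∀ {s} → Fin s → Fin s × Fin s → Bool
avoids z (a , b) = not (does (z ≟ a)) ∧ not (does (z ≟ b))

module _ {n} (H : ThreeGraph n) where

  joins : ∀ {s} → (Fin s → Fin n) → Fin s × Fin s → Fin n → Bool
  joins S (a , b) c = edge H (S a) (S b) c

  joins-at-member : ∀ {s} (S : Fin s → Fin n) a b z →
                 bit (edge H (S a) (S b) (S z)) ≤ bit (not (does (z ≟ a)) ∧ not (does (z ≟ b)))
  joins-at-member S a b z with z ≟ a | z ≟ b
  ... | yes refl | _        = ≤-reflexive (cong bit (trans (sym₂₃ H (S z) (S b) (S z)) (loopless H (S z) (S b))))
  ... | no _     | yes refl = ≤-reflexive (cong bit (trans (sym₁₂ H (S a) (S z) (S z))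
                                (trans (sym₂₃ H (S z) (S a) (S z)) (loopless H (S z) (S a)))))
  ... | no _     | no _     = bit≤1 _

  module _ {s p} (S : Fin s → Fin n) (S-injective : Injective _≡_ _≡_ S)
           (pr : Vector (Fin s × Fin s) p) (pr-distinct : ∀ i → proj₁ (pr i) ≢ proj₂ (pr i)) where

    degree : Fin n → ℕ
    degree c = ∑[ z < s ] bit (does (c ≟ S z)) + ∑[ i < p ] bit (joins S (pr i) c)

    ∑-degree : s + p * δ₂ H ≤ ∑[ c < n ] degree c
    ∑-degree = begin
      s + p * δ₂ H
        ≡⟨ cong₂ _+_ (trans (∑-const s 1) (*-identityʳ s)) (∑-const p (δ₂ H)) ⟨
      ∑[ z < s ] 1 + ∑[ i < p ] δ₂ H
        ≤⟨ +-monoʳ-≤ _ (∑-mono-≤ λ i → δ₂≤codeg H (pr-distinct i ∘ S-injective)) ⟩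
      ∑[ z < s ] 1 + ∑[ i < p ] codeg H (S (proj₁ (pr i))) (S (proj₂ (pr i)))
        ≡⟨ cong₂ _+_ (sum-cong-≗ (sym ∘ ∑-indicator ∘ S))
                     (sum-cong-≗ λ i → codeg-∑ H (S (proj₁ (pr i))) (S (proj₂ (pr i)))) ⟩
      ∑[ z < s ] ∑[ c < n ] bit (does (c ≟ S z)) + ∑[ i < p ] ∑[ c < n ] bit (joins S (pr i) c)
        ≡⟨ cong₂ _+_ (∑-comm λ z c → bit (does (c ≟ S z))) (∑-comm λ i c → bit (joins S (pr i) c)) ⟩
      ∑[ c < n ] ∑[ z < s ] bit (does (c ≟ S z)) + ∑[ c < n ] ∑[ i < p ] bit (joins S (pr i) c)
        ≡⟨ ∑-distrib-+ (λ c → ∑[ z < s ] bit (does (c ≟ S z))) (λ c → ∑[ i < p ] bit (joins S (pr i) c)) ⟨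
      ∑[ c < n ] degree c ∎
      where open ≤-Reasoning

    degree-at-member : ∀ z → degree (S z) ≤ suc (∑[ i < p ] bit (avoids z (pr i)))
    degree-at-member z = +-mono-≤
      (≤-reflexive (trans (sum-cong-≗ λ z′ → cong bit (does-⇔ (mk⇔ (sym ∘ S-injective) (cong S ∘ sym))
                                                               (S z ≟ S z′) (z′ ≟ z)))
                          (∑-indicator z)))
      (∑-mono-≤ λ i → joins-at-member S (proj₁ (pr i)) (proj₂ (pr i)) z)

    -- Members of S weigh at most k, so the heavy vertex found by counting lies outside S.
    common-neighbour : ∀ k → (∀ z → ∑[ i < p ] bit (avoids z (pr i)) < k) → n * k < s + p * δ₂ H →
                       ∃ λ c → k < ∑[ i < p ] bit (joins S (pr i) c)
    common-neighbour k avoid<k n*k<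
      with ∑-pigeonhole k degree (<-≤-trans n*k< ∑-degree)
    ... | c , k<degree with any? (λ z → c ≟ S z)
    ...   | yes (z , refl) = contradiction k<degree (≤⇒≯ (≤-trans (degree-at-member z) (avoid<k z)))
    ...   | no  c∉S = c , subst (λ d → k < d + _) outside k<degree
      where outside : ∑[ z < s ] bit (does (c ≟ S z)) ≡ 0
            outside = trans (sum-cong-≗ λ z → cong bit (dec-false (c ≟ S z) (c∉S ∘ (z ,_)))) (∑-zero s)

-- Covering by K₅⁻ when the minimum codegree is large

triangle-pairs : Vector (Fin 3 × Fin 3) 3
triangle-pairs = (# 0 , # 1) ∷ (# 0 , # 2) ∷ (# 1 , # 2) ∷ []

K4-pairs : Vector (Fin 4 × Fin 4) 6
K4-pairs = (# 0 , # 1) ∷ (# 0 , # 2) ∷ (# 0 , # 3) ∷ (# 1 , # 2) ∷ (# 1 , # 3) ∷ (# 2 , # 3) ∷ []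

triangle : Vector (Triple 3) 1
triangle = (# 0 , # 1 , # 2) ∷ []

K4-triples : Vector (Triple 4) 4
K4-triples = lift triangle ++ cone triangle-pairs

-- The edges available once a fifth vertex (index 0) is joined to all pairs of a K₄ (indices 1–4)
-- except the j-th one.
K4-cone-except : Fin 6 → Vector (Triple 5) 9
K4-cone-except j = lift K4-triples ++ removeAt (cone K4-pairs) j

-- Where K₅⁻ sits inside K4-cone-except j: the two vertices outside the missing pair are the
-- apexes 0, 1 of K₅⁻, the missing pair and the fifth vertex its base 2, 3, 4.
relabel : Fin 6 → Fin 5 → Fin 5
relabel =
  (# 3 ∷ # 4 ∷ # 1 ∷ # 2 ∷ # 0 ∷ []) ∷ (# 2 ∷ # 4 ∷ # 1 ∷ # 3 ∷ # 0 ∷ []) ∷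
  (# 2 ∷ # 3 ∷ # 1 ∷ # 4 ∷ # 0 ∷ []) ∷ (# 1 ∷ # 4 ∷ # 2 ∷ # 3 ∷ # 0 ∷ []) ∷
  (# 1 ∷ # 3 ∷ # 2 ∷ # 4 ∷ # 0 ∷ []) ∷ (# 1 ∷ # 2 ∷ # 3 ∷ # 4 ∷ # 0 ∷ []) ∷ []

spanning-triangle : Spanning triangle
spanning-triangle = from-yes (spanning? triangle)

spanning-K4 : Spanning K4-triples
spanning-K4 = from-yes (spanning? K4-triples)

triangle-pairs-distinct : ∀ i → proj₁ (triangle-pairs i) ≢ proj₂ (triangle-pairs i)
triangle-pairs-distinct = from-yes (all? λ i → ¬? (proj₁ (triangle-pairs i) ≟ proj₂ (triangle-pairs i)))

K4-pairs-distinct : ∀ i → proj₁ (K4-pairs i) ≢ proj₂ (K4-pairs i)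
K4-pairs-distinct = from-yes (all? λ i → ¬? (proj₁ (K4-pairs i) ≟ proj₂ (K4-pairs i)))

triangle-avoids : ∀ z → ∑[ i < 3 ] bit (avoids z (triangle-pairs i)) < 2
triangle-avoids = from-yes (all? λ z → ∑[ i < 3 ] bit (avoids z (triangle-pairs i)) <? 2)

K4-avoids : ∀ z → ∑[ i < 6 ] bit (avoids z (K4-pairs i)) < 4
K4-avoids = from-yes (all? λ z → ∑[ i < 6 ] bit (avoids z (K4-pairs i)) <? 4)

K5⁻-joined : ∀ a b → a ≢ b → ∃ λ c → K5e a b c ≡ true
K5⁻-joined = from-yes (all? λ a → all? λ b → ¬? (a ≟ b) →-dec any? λ c → K5e a b c ≟ᵇ true)

relabel-within : ∀ j a b c → K5e a b c ≡ true → Within (K4-cone-except j) (relabel j a , relabel j b , relabel j c)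
relabel-within = from-yes (all? λ j → all? λ a → all? λ b → all? λ c →
  (K5e a b c ≟ᵇ true) →-dec within? (K4-cone-except j) (relabel j a , relabel j b , relabel j c))

relabel-onto : ∀ j w → ∃ λ i → relabel j i ≡ w
relabel-onto = from-yes (all? λ j → all? λ w → any? λ i → relabel j i ≟ w)

module Dense {n} (H : ThreeGraph n) (dense : 2 * n ≤ 3 * δ₂ H + 1) where

  δ₂-positive : Fin n → 0 < δ₂ H
  δ₂-positive v = n≢0⇒n>0 λ δ₂≡0 →
    <⇒≱ (*-monoʳ-≤ 2 (≤-trans (s≤s z≤n) (toℕ<n v))) (subst (λ d → 2 * n ≤ 3 * d + 1) δ₂≡0 dense)

  pair-in-edge : ∀ {v u} → v ≢ u → ∃ λ w → edge H v u w ≡ true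
  pair-in-edge {v} {u} v≢u with ∑-pigeonhole 0 (bit ∘ edge H v u) n*0<codeg
    where
    n*0<codeg : n * 0 < ∑[ c < n ] bit (edge H v u c)
    n*0<codeg = subst₂ _<_ (sym (*-zeroʳ n)) (codeg-∑ H v u) (<-≤-trans (δ₂-positive v) (δ₂≤codeg H v≢u))
  ... | w , 0<bit = w , bit-positive 0<bit

  triangle-in-K4 : ∀ {v u w} → edge H v u w ≡ true → ∃ λ x → Realizes H (x ∷ v ∷ u ∷ w ∷ []) K4-triples
  triangle-in-K4 {v} {u} {w} vuw =
    let x , 2<joins = found in
    x , λ { zero → vuw ; (suc i) → all-true (λ i → joins H (v ∷ u ∷ w ∷ []) (triangle-pairs i) x) 2<joins i }
    where
    bound : n * 2 < 3 + 3 * δ₂ H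
    bound = begin-strict
      n * 2             ≡⟨ *-comm n 2 ⟩
      2 * n             ≤⟨ dense ⟩
      3 * δ₂ H + 1      <⟨ +-monoʳ-< (3 * δ₂ H) (s≤s (s≤s z≤n)) ⟩
      3 * δ₂ H + 3      ≡⟨ +-comm (3 * δ₂ H) 3 ⟩
      3 + 3 * δ₂ H      ∎
      where open ≤-Reasoning
    found : ∃ λ x → 2 < ∑[ i < 3 ] bit (joins H (v ∷ u ∷ w ∷ []) (triangle-pairs i) x)
    found = common-neighbour H (v ∷ u ∷ w ∷ []) (realizes-injective H {ts = triangle} (λ { zero → vuw }) spanning-triangle)
                          triangle-pairs triangle-pairs-distinct 2 triangle-avoids bound

  K4-in-K5⁻ : ∀ {S} → Realizes H S K4-triples → ∀ z → ∃ λ (C : Copy K5⁻ H) → ∃ λ i → φ C i ≡ S z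
  K4-in-K5⁻ {S} K4 z =
    let y , 4<joins = found
        j , joined = all-but-one-true (λ i → joins H S (K4-pairs i) y) 4<joins
        cone-edges : Realizes H (y ∷ S) (K4-cone-except j)
        cone-edges = all-++ {P = EdgeAt H (y ∷ S)} {xs = lift K4-triples} K4
                            (λ i → joined (punchIn j i) (punchInᵢ≢i j i))
        i , relabel-i = relabel-onto j (suc z)
    in copy H K5⁻ ((y ∷ S) ∘ relabel j) K5⁻-joined
         (λ a b c e → edgeAt-within H {ψ = y ∷ S} {ts = K4-cone-except j} {t = relabel j a , relabel j b , relabel j c}
                                    cone-edges (relabel-within j a b c e))
       , i , cong (y ∷ S) relabel-i
    where
    bound : n * 4 < 4 + 6 * δ₂ H
    bound = begin-strict
      n * 4                   ≡⟨ *-comm n 4 ⟩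
      4 * n                   ≡⟨ *-assoc 2 2 n ⟩
      2 * (2 * n)             ≤⟨ *-monoʳ-≤ 2 dense ⟩
      2 * (3 * δ₂ H + 1)      ≡⟨ *-distribˡ-+ 2 (3 * δ₂ H) 1 ⟩
      2 * (3 * δ₂ H) + 2      ≡⟨ cong (_+ 2) (*-assoc 2 3 (δ₂ H)) ⟨
      6 * δ₂ H + 2            <⟨ +-monoʳ-< (6 * δ₂ H) (s≤s (s≤s (s≤s z≤n))) ⟩
      6 * δ₂ H + 4            ≡⟨ +-comm (6 * δ₂ H) 4 ⟩
      4 + 6 * δ₂ H            ∎
      where open ≤-Reasoning
    found : ∃ λ y → 4 < ∑[ i < 6 ] bit (joins H S (K4-pairs i) y)
    found = common-neighbour H S (realizes-injective H {ts = K4-triples} K4 spanning-K4)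
                             K4-pairs K4-pairs-distinct 4 K4-avoids bound

another : ∀ {n} (v : Fin (suc (suc n))) → ∃ λ u → v ≢ u
another zero    = suc zero , λ ()
another (suc v) = zero , λ ()

dense-covering : ∀ {n} (H : ThreeGraph (suc (suc n))) → 2 * suc (suc n) ≤ 3 * δ₂ H + 1 →
                 HasCovering K5⁻ H
dense-covering H dense v =
  let u , v≢u = another v
      w , vuw = pair-in-edge v≢u
      x , K4  = triangle-in-K4 vuw
  in K4-in-K5⁻ {x ∷ v ∷ u ∷ w ∷ []} K4 (# 1)
  where open Dense H dense

-- The extremal construction

module _ (M : ℕ) .{{_ : NonZero M}} where

  balancer : ℕ → ℕ
  balancer A = (M ∸ A % M) % M

  balancer<M : ∀ A → balancer A < M
  balancer<M A = m%n<n (M ∸ A % M) M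

  balancer-balances : ∀ A → (A + balancer A) % M ≡ 0
  balancer-balances A = begin
    (A + (M ∸ a) % M) % M          ≡⟨ %-distribˡ-+ A ((M ∸ a) % M) M ⟩
    (a + (M ∸ a) % M % M) % M      ≡⟨ cong (λ t → (a + t) % M) (m%n%n≡m%n (M ∸ a) M) ⟩
    (a + (M ∸ a) % M) % M          ≡⟨ cong (λ s → (s + (M ∸ a) % M) % M) (m%n%n≡m%n A M) ⟨
    (a % M + (M ∸ a) % M) % M      ≡⟨ %-distribˡ-+ a (M ∸ a) M ⟨
    (a + (M ∸ a)) % M              ≡⟨ cong (_% M) (m+[n∸m]≡n (<⇒≤ (m%n<n A M))) ⟩
    M % M                          ≡⟨ n%n≡0 M ⟩
    0                              ∎
    where
    open ≡-Reasoning
    a = A % M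

  balancer-unique : ∀ A r → r < M → (A + r) % M ≡ 0 → r ≡ balancer A
  balancer-unique A r r<M balanced = begin
    r                                 ≡⟨ m<n⇒m%n≡m r<M ⟨
    r % M                             ≡⟨ [m+kn]%n≡m%n r 1 M ⟨
    (r + 1 * M) % M                   ≡⟨ cong (λ t → (r + t) % M)
                                             (trans (*-identityˡ M) (sym (m+[n∸m]≡n (<⇒≤ (m%n<n A M))))) ⟩
    (r + (a + (M ∸ a))) % M           ≡⟨ cong (_% M) (+-assoc r a (M ∸ a)) ⟨
    (r + a + (M ∸ a)) % M             ≡⟨ %-distribˡ-+ (r + a) (M ∸ a) M ⟩
    ((r + a) % M + (M ∸ a) % M) % M   ≡⟨ cong (λ s → (s + (M ∸ a) % M) % M) r+a≡0 ⟩
    (M ∸ a) % M % M                   ≡⟨ m%n%n≡m%n (M ∸ a) M ⟩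
    balancer A                        ∎
    where
    open ≡-Reasoning
    a = A % M
    r+a≡0 : (r + a) % M ≡ 0
    r+a≡0 = begin
      (r + A % M) % M            ≡⟨ %-distribˡ-+ r (A % M) M ⟩
      (r % M + A % M % M) % M    ≡⟨ cong (λ s → (r % M + s) % M) (m%n%n≡m%n A M) ⟩
      (r % M + A % M) % M        ≡⟨ %-distribˡ-+ r A M ⟨
      (r + A) % M                ≡⟨ cong (_% M) (+-comm r A) ⟩
      (A + r) % M                ≡⟨ balanced ⟩
      0                          ∎

third-of-Fin3 : ∀ (p q x : Fin 3) → p ≢ q → x ≢ p → x ≢ q → toℕ x ≡ 3 ∸ (toℕ p + toℕ q)
third-of-Fin3 = from-yes (all? λ (p : Fin 3) → all? λ (q : Fin 3) → all? λ (x : Fin 3) →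
  ¬? (p ≟ q) →-dec ¬? (x ≟ p) →-dec ¬? (x ≟ q) →-dec toℕ x ≟ℕ 3 ∸ (toℕ p + toℕ q))

third-part : ∀ {p q x} → p < 3 → q < 3 → x < 3 → p ≢ q → x ≢ p → x ≢ q → x ≡ 3 ∸ (p + q)
third-part p<3 q<3 x<3 p≢q x≢p x≢q =
  subst₂ (λ x′ s → x′ ≡ 3 ∸ s) (toℕ-fromℕ< x<3) (cong₂ _+_ (toℕ-fromℕ< p<3) (toℕ-fromℕ< q<3))
    (third-of-Fin3 _ _ _ (distinct p<3 q<3 p≢q) (distinct x<3 p<3 x≢p) (distinct x<3 q<3 x≢q))
  where
  distinct : ∀ {a b} (a<3 : a < 3) (b<3 : b < 3) → a ≢ b → fromℕ< a<3 ≢ fromℕ< b<3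
  distinct a<3 b<3 a≢b eq = a≢b (trans (sym (toℕ-fromℕ< a<3)) (trans (cong toℕ eq) (toℕ-fromℕ< b<3)))

-- The configuration around a vertex i of K₅⁻ that rules out copies through the special vertex.
Fan : Fin 5 → Fin 5 → Fin 5 → Fin 5 → Fin 5 → Set
Fan i p q r s = K5e i p q ≡ true × K5e i p r ≡ true × K5e i p s ≡ true × K5e i q r ≡ true ×
                K5e i q s ≡ true × K5e p q r ≡ true × K5e p q s ≡ true × r ≢ s

opaque
  fan : ∀ i → ∃ λ p → ∃ λ q → ∃ λ r → ∃ λ s → Fan i p q r s
  fan = from-yes (all? λ i → any? λ p → any? λ q → any? λ r → any? λ s →
    K5e i p q ≟ᵇ true ×-dec K5e i p r ≟ᵇ true ×-dec K5e i p s ≟ᵇ true ×-dec K5e i q r ≟ᵇ true ×-dec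
    K5e i q s ≟ᵇ true ×-dec K5e p q r ≟ᵇ true ×-dec K5e p q s ≟ᵇ true ×-dec ¬? (r ≟ s))

-- Vertex 0 is the special vertex; vertex suc k lies in part k / M with coordinate k % M. Giving 0 the
-- fictitious part 3 makes the triples 0xy with x, y in different parts the "rainbow" triples through 0.
module Construction (M′ n : ℕ) (n≤1+3M : n ≤ 1 + 3 * suc M′) where

  M : ℕ
  M = suc M′

  part : ℕ → ℕ
  part zero    = 3
  part (suc k) = k / M

  coord : ℕ → ℕ
  coord zero    = 0
  coord (suc k) = k % M

  Rainbow : ℕ → ℕ → ℕ → Set
  Rainbow x y z = Distinct (part x) (part y) (part z)

  HasZero : ℕ → ℕ → ℕ → Set
  HasZero = AnyOf (_≡ 0)

  Balanced : ℕ → ℕ → ℕ → Set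
  Balanced x y z = (coord x + coord y + coord z) % M ≡ 0

  Edge : ℕ → ℕ → ℕ → Set
  Edge x y z = Distinct x y z ×
               (Rainbow x y z × (HasZero x y z ⊎ Balanced x y z) ⊎ ¬ Rainbow x y z × ¬ HasZero x y z)

  edge? : ∀ x y z → Dec (Edge x y z)
  edge? x y z = distinct? x y z ×-dec (rainbow? ×-dec (zero? ⊎-dec balanced?) ⊎-dec ¬? rainbow? ×-dec ¬? zero?)
    where
    distinct? : ∀ x y z → Dec (Distinct x y z)
    distinct? x y z = ¬? (x ≟ℕ y) ×-dec ¬? (y ≟ℕ z) ×-dec ¬? (x ≟ℕ z)
    rainbow?  = distinct? (part x) (part y) (part z)
    zero?     = (x ≟ℕ 0) ⊎-dec (y ≟ℕ 0) ⊎-dec (z ≟ℕ 0)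
    balanced? = (coord x + coord y + coord z) % M ≟ℕ 0

  Edge-symmetric : Symmetric₃ Edge
  Edge-symmetric =
    ×-symmetric distinct-symmetric
      (⊎-symmetric (×-symmetric rainbow (⊎-symmetric anyOf-symmetric (sum-symmetric (λ s → s % M ≡ 0) coord)))
                   (×-symmetric (¬-symmetric rainbow) (¬-symmetric anyOf-symmetric)))
    where rainbow = ∘-symmetric part distinct-symmetric

  extremal : ThreeGraph n
  extremal = fromPredicate edge? Edge-symmetric (λ x z ((x≢x , _) , _) → x≢x refl) n

  edge-true : ∀ {a b c} → Edge (toℕ a) (toℕ b) (toℕ c) → edge extremal a b c ≡ true
  edge-true {a} {b} {c} = dec-true (edge? (toℕ a) (toℕ b) (toℕ c))

  edge-sound : ∀ {a b c} → edge extremal a b c ≡ true → Edge (toℕ a) (toℕ b) (toℕ c)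
  edge-sound {a} {b} {c} = does-true (edge? (toℕ a) (toℕ b) (toℕ c))

  part<3 : ∀ {k} → suc k < n → k / M < 3
  part<3 sk<n = m<n*o⇒m/o<n (≤-pred (<-≤-trans sk<n n≤1+3M))

  place : ∀ k → k ≡ k / M * M + k % M
  place k = trans (m≡m%n+[m/n]*n k M) (+-comm (k % M) (k / M * M))

  same-place : ∀ {k l} → k / M ≡ l / M → k % M ≡ l % M → k ≡ l
  same-place {k} {l} same-part same-coord =
    trans (place k) (trans (cong₂ (λ p c → p * M + c) same-part same-coord) (sym (place l)))

  distinct-suc : ∀ {i j l} → i ≢ j → l ≢ i → l ≢ j → Distinct (suc i) (suc j) (suc l)
  distinct-suc i≢j l≢i l≢j = i≢j ∘ suc-injective , l≢j ∘ sym ∘ suc-injective , l≢i ∘ sym ∘ suc-injective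

  no-zero : ∀ {x y z} → ¬ HasZero (suc x) (suc y) (suc z)
  no-zero (inj₁ ())
  no-zero (inj₂ (inj₁ ()))
  no-zero (inj₂ (inj₂ ()))

  zero-link : ∀ {y z} → Edge 0 y z → part y ≢ part z
  zero-link (_ , inj₁ ((_ , y≢z , _) , _)) = y≢z
  zero-link (_ , inj₂ (_ , ¬zero))          = contradiction (inj₁ refl) ¬zero

  rainbow-balanced : ∀ {x y z} → Edge (suc x) (suc y) (suc z) → Rainbow (suc x) (suc y) (suc z) →
                     Balanced (suc x) (suc y) (suc z)
  rainbow-balanced (_ , inj₁ (_ , inj₂ balanced)) _       = balanced
  rainbow-balanced (_ , inj₁ (_ , inj₁ has-zero)) _       = contradiction has-zero no-zero
  rainbow-balanced (_ , inj₂ (¬rainbow , _))      rainbow = contradiction rainbow ¬rainbow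

  -- The link of 0 is 3-partite, so r and s both lie in the part missed by p and q; both balance the
  -- coordinates of p and q, so they also share their coordinate.
  no-fan-at-zero : ∀ {p q r s} → p < n → q < n → r < n → s < n →
                   Edge 0 p q → Edge 0 p r → Edge 0 p s → Edge 0 q r → Edge 0 q s →
                   Edge p q r → Edge p q s → r ≡ s
  no-fan-at-zero {zero}  _ _ _ _ ((0≢0 , _) , _) _ _ _ _ _ _ = contradiction refl 0≢0
  no-fan-at-zero {q = zero} _ _ _ _ ((_ , _ , 0≢0) , _) _ _ _ _ _ _ = contradiction refl 0≢0
  no-fan-at-zero {r = zero} _ _ _ _ _ ((_ , _ , 0≢0) , _) _ _ _ _ _ = contradiction refl 0≢0
  no-fan-at-zero {s = zero} _ _ _ _ _ _ ((_ , _ , 0≢0) , _) _ _ _ _ = contradiction refl 0≢0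
  no-fan-at-zero {suc p} {suc q} {suc r} {suc s} p<n q<n r<n s<n 0pq 0pr 0ps 0qr 0qs pqr pqs =
    cong suc (same-place (trans (third r<n 0pr 0qr) (sym (third s<n 0ps 0qs)))
                         (trans (balancing pqr 0pr 0qr) (sym (balancing pqs 0ps 0qs))))
    where
    third : ∀ {t} → suc t < n → Edge 0 (suc p) (suc t) → Edge 0 (suc q) (suc t) →
            t / M ≡ 3 ∸ (p / M + q / M)
    third t<n 0pt 0qt = third-part (part<3 p<n) (part<3 q<n) (part<3 t<n)
                                   (zero-link 0pq) (zero-link 0pt ∘ sym) (zero-link 0qt ∘ sym)
    balancing : ∀ {t} → Edge (suc p) (suc q) (suc t) → Edge 0 (suc p) (suc t) → Edge 0 (suc q) (suc t) →
                t % M ≡ balancer M (p % M + q % M)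
    balancing {t} pqt 0pt 0qt = balancer-unique M (p % M + q % M) (t % M) (m%n<n t M)
      (rainbow-balanced pqt (zero-link 0pq , zero-link 0qt , zero-link 0pt))

  zero-uncovered : (C : Copy K5⁻ extremal) (i : Fin 5) → toℕ (φ C i) ≢ 0
  zero-uncovered C i φi≡0 =
    let p , q , r , s , ipq , ipr , ips , iqr , iqs , pqr , pqs , r≢s = fan i
    in r≢s (inj C (toℕ-injective (no-fan-at-zero (below p) (below q) (below r) (below s)
             (at-zero ipq) (at-zero ipr) (at-zero ips) (at-zero iqr) (at-zero iqs) (at pqr) (at pqs))))
    where
    below : ∀ j → toℕ (φ C j) < n
    below j = toℕ<n (φ C j)
    at : ∀ {a b c} → K5e a b c ≡ true → Edge (toℕ (φ C a)) (toℕ (φ C b)) (toℕ (φ C c))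
    at {a} {b} {c} e = edge-sound (edges C a b c e)
    at-zero : ∀ {a b} → K5e i a b ≡ true → Edge 0 (toℕ (φ C a)) (toℕ (φ C b))
    at-zero e = subst (λ v → Edge v _ _) φi≡0 (at e)

  JoinedToAllBut : ℕ → ℕ → ℕ → Set
  JoinedToAllBut k x y = ∃ λ (g : Fin k → ℕ) → ∀ c → c < n → Edge x y c ⊎ ∃ λ i → c ≡ g i

  joined-swap : ∀ {k x y} → JoinedToAllBut k x y → JoinedToAllBut k y x
  joined-swap (g , covered) = g , λ c c<n → Sum.map₁ (Symmetric₃.swap₁₂ Edge-symmetric) (covered c c<n)

  zero-pair-joined : ∀ {k} → suc k < n → JoinedToAllBut (suc M) 0 (suc k)
  zero-pair-joined {k} sk<n = exceptions , covered
    where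
    exceptions : Fin (suc M) → ℕ
    exceptions zero    = 0
    exceptions (suc r) = suc (k / M * M + toℕ r)
    covered : ∀ c → c < n → Edge 0 (suc k) c ⊎ ∃ λ i → c ≡ exceptions i
    covered zero    _    = inj₂ (zero , refl)
    covered (suc l) sl<n with l / M ≟ℕ k / M
    ... | yes same = inj₂ (suc (fromℕ< (m%n<n l M)) ,
                          cong suc (trans (place l) (cong₂ _+_ (cong (_* M) same) (sym (toℕ-fromℕ< _)))))
    ... | no differ = inj₁ (((λ ()) , differ ∘ cong part ∘ sym , (λ ())) ,
                            inj₁ ((<⇒≢ (part<3 sk<n) ∘ sym , differ ∘ sym , <⇒≢ (part<3 sl<n) ∘ sym) ,
                                  inj₁ (inj₁ refl)))

  same-part-joined : ∀ {i j} → i ≢ j → i / M ≡ j / M → JoinedToAllBut (suc M) (suc i) (suc j)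
  same-part-joined {i} {j} i≢j same = exceptions , covered
    where
    -- two vertices in one part force M ≥ 2, which leaves room for a third exception
    M′≢0 : M′ ≢ 0
    M′≢0 M′≡0 = i≢j (trans (sym (n/1≡n i))
                      (trans (subst (λ m → i / suc m ≡ j / suc m) M′≡0 same) (n/1≡n j)))
    exceptions : Fin (suc M) → ℕ
    exceptions zero          = 0
    exceptions (suc zero)    = suc i
    exceptions (suc (suc _)) = suc j
    covered : ∀ c → c < n → Edge (suc i) (suc j) c ⊎ ∃ λ r → c ≡ exceptions r
    covered zero    _ = inj₂ (zero , refl)
    covered (suc l) _ with l ≟ℕ i | l ≟ℕ j
    ... | yes refl | _        = inj₂ (suc zero , refl)
    ... | no _     | yes refl = inj₂ (suc (suc (fromℕ< (n≢0⇒n>0 M′≢0))) , refl)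
    ... | no l≢i   | no l≢j   = inj₁ (distinct-suc i≢j l≢i l≢j , inj₂ ((λ (P≢Q , _) → P≢Q same) , no-zero))

  cross-joined : ∀ {i j} → suc i < n → suc j < n → i / M ≢ j / M → JoinedToAllBut (suc M) (suc i) (suc j)
  cross-joined {i} {j} si<n sj<n P≢Q = exceptions , covered
    where
    i≢j : i ≢ j
    i≢j = P≢Q ∘ cong (_/ M)
    A = i % M + j % M
    β : Fin M
    β = fromℕ< (balancer<M M A)
    τ = 3 ∸ (i / M + j / M)
    exceptions : Fin (suc M) → ℕ
    exceptions zero          = suc i
    exceptions (suc zero)    = suc j
    exceptions (suc (suc r)) = suc (τ * M + toℕ (punchIn β r))
    covered : ∀ c → c < n → Edge (suc i) (suc j) c ⊎ ∃ λ r → c ≡ exceptions r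
    covered zero _ =
      inj₁ ((i≢j ∘ suc-injective , (λ ()) , (λ ())) ,
            inj₁ ((P≢Q , <⇒≢ (part<3 sj<n) , <⇒≢ (part<3 si<n)) , inj₁ (inj₂ (inj₂ refl))))
    covered (suc l) sl<n with l ≟ℕ i | l ≟ℕ j
    ... | yes refl | _        = inj₂ (zero , refl)
    ... | no _     | yes refl = inj₂ (suc zero , refl)
    ... | no l≢i   | no l≢j   with l / M ≟ℕ i / M | l / M ≟ℕ j / M
    ...   | yes R≡P | _       =
      inj₁ (distinct-suc i≢j l≢i l≢j , inj₂ ((λ (_ , _ , P≢R) → P≢R (sym R≡P)) , no-zero))
    ...   | no _    | yes R≡Q =
      inj₁ (distinct-suc i≢j l≢i l≢j , inj₂ ((λ (_ , Q≢R , _) → Q≢R (sym R≡Q)) , no-zero))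
    ...   | no R≢P  | no R≢Q  with fromℕ< (m%n<n l M) ≟ β
    ...     | yes balancing =
      inj₁ (distinct-suc i≢j l≢i l≢j , inj₁ ((P≢Q , R≢Q ∘ sym , R≢P ∘ sym) , inj₂ balanced))
      where
      balanced : (A + l % M) % M ≡ 0
      balanced = subst (λ t → (A + t) % M ≡ 0)
                   (trans (sym (toℕ-fromℕ< _)) (trans (cong toℕ (sym balancing)) (toℕ-fromℕ< _)))
                   (balancer-balances M A)
    ...     | no unbalanced = inj₂ (suc (suc (punchOut (unbalanced ∘ sym))) , cong suc in-third-part)
      where
      in-third-part : l ≡ τ * M + toℕ (punchIn β (punchOut (unbalanced ∘ sym)))
      in-third-part = trans (place l) (cong₂ _+_
        (cong (_* M) (third-part (part<3 si<n) (part<3 sj<n) (part<3 sl<n) P≢Q R≢P R≢Q))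
        (trans (sym (toℕ-fromℕ< _)) (cong toℕ (sym (punchIn-punchOut (unbalanced ∘ sym))))))

  pair-joined : ∀ {x y} → x < n → y < n → x ≢ y → JoinedToAllBut (suc M) x y
  pair-joined {zero}  {zero}  _    _    0≢0 = contradiction refl 0≢0
  pair-joined {zero}  {suc k} _    sk<n _   = zero-pair-joined sk<n
  pair-joined {suc k} {zero}  sk<n _    _   = joined-swap (zero-pair-joined sk<n)
  pair-joined {suc i} {suc j} si<n sj<n si≢sj with i / M ≟ℕ j / M
  ... | yes same  = same-part-joined (si≢sj ∘ cong suc) same
  ... | no differ = cross-joined si<n sj<n differ

  codeg-lower : ∀ a b → a ≢ b → n ≤ codeg extremal a b + suc M
  codeg-lower a b a≢b =
    let g , covered = pair-joined (toℕ<n a) (toℕ<n b) (a≢b ∘ toℕ-injective)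
    in codeg-≥ extremal {a} {b} g λ c → Sum.map₁ (edge-true {a} {b} {c}) (covered (toℕ c) (toℕ<n c))

  zero-one-non-edge : ∀ {c} → c ≤ M → ¬ Edge 0 1 c
  zero-one-non-edge {zero}  _    ((_ , _ , 0≢0) , _)        = 0≢0 refl
  zero-one-non-edge {suc l} sl≤M (_ , inj₁ ((_ , 0≢R , _) , _)) = 0≢R (sym (m<n⇒m/n≡0 sl≤M))
  zero-one-non-edge {suc l} _    (_ , inj₂ (_ , ¬zero))        = ¬zero (inj₁ refl)

  zero-one-codeg : ∀ {a b} → toℕ a ≡ 0 → toℕ b ≡ 1 → codeg extremal a b ≤ n ∸ suc M
  zero-one-codeg {a} {b} a≡0 b≡1 = begin
    codeg extremal a b
      ≡⟨ codeg-∑ extremal a b ⟩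
    ∑[ c < n ] bit (does (edge? (toℕ a) (toℕ b) (toℕ c)))
      ≡⟨ cong₂ (λ x y → ∑[ c < n ] bit (does (edge? x y (toℕ c)))) a≡0 b≡1 ⟩
    ∑[ c < n ] bit (does (edge? 0 1 (toℕ c)))
      ≤⟨ count-above n (suc M) (does ∘ edge? 0 1)
           (λ c c≤M → dec-false (edge? 0 1 c) (zero-one-non-edge (≤-pred c≤M))) ⟩
    n ∸ suc M ∎
    where open ≤-Reasoning

  δ₂-extremal : ∀ {m} (a b : Fin n) → toℕ a ≡ 0 → toℕ b ≡ 1 → m + suc M ≡ n → δ₂ extremal ≡ m
  δ₂-extremal {m} a b a≡0 b≡1 m+M+1≡n = ≤-antisym
    (begin
      δ₂ extremal          ≤⟨ δ₂≤codeg extremal a≢b ⟩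
      codeg extremal a b   ≤⟨ zero-one-codeg a≡0 b≡1 ⟩
      n ∸ suc M            ≡⟨ cong (_∸ suc M) m+M+1≡n ⟨
      m + suc M ∸ suc M    ≡⟨ m+n∸n≡m m (suc M) ⟩
      m                    ∎)
    (≤δ₂ extremal (subst (m ≤_) m+M+1≡n (m≤m+n m (suc M))) λ a b a≢b →
      +-cancelʳ-≤ (suc M) m (codeg extremal a b)
                  (subst (_≤ codeg extremal a b + suc M) (sym m+M+1≡n) (codeg-lower a b a≢b)))
    where
    open ≤-Reasoning
    a≢b : a ≢ b
    a≢b a≡b = 0≢1+n (trans (sym a≡0) (trans (cong toℕ a≡b) b≡1))

  extremal-uncovered : ∀ v → toℕ v ≡ 0 → ¬ HasCovering K5⁻ extremal
  extremal-uncovered v v≡0 cover = let C , i , φi≡v = cover v in zero-uncovered C i (trans (cong toℕ φi≡v) v≡0)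

dense-above-floor : ∀ {n d} → (2 * n ∸ 2) / 3 < d → 2 * n ≤ 3 * d + 1
dense-above-floor {n} {d} m<d = begin
  2 * n                           ≤⟨ m≤n+m∸n (2 * n) 2 ⟩
  2 + (2 * n ∸ 2)                 ≡⟨ cong (2 +_) (m≡m%n+[m/n]*n (2 * n ∸ 2) 3) ⟩
  2 + ((2 * n ∸ 2) % 3 + m * 3)   ≤⟨ +-monoʳ-≤ 2 (+-monoˡ-≤ (m * 3) (≤-pred (m%n<n (2 * n ∸ 2) 3))) ⟩
  1 + suc m * 3                   ≤⟨ +-monoʳ-≤ 1 (*-monoˡ-≤ 3 m<d) ⟩
  1 + d * 3                       ≡⟨ trans (+-comm 1 (d * 3)) (cong (_+ 1) (*-comm d 3)) ⟩
  3 * d + 1                       ∎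
  where
  open ≤-Reasoning
  m = (2 * n ∸ 2) / 3

floor-split : ∀ n → 3 ≤ n → ∃ λ M′ → (2 * n ∸ 2) / 3 + suc (suc M′) ≡ n × n ≤ 1 + 3 * suc M′
floor-split n 3≤n = n ∸ (2 + m) , sum≡n , +-cancelˡ-≤ (2 * n) n (1 + 3 * M) bound
  where
  t = 2 * n ∸ 2
  m = t / 3
  M = suc (n ∸ (2 + m))
  2+t≡2n : 2 + t ≡ 2 * n
  2+t≡2n = m+[n∸m]≡n (*-monoʳ-≤ 2 (≤-trans (s≤s z≤n) 3≤n))
  3m≤t : m * 3 ≤ t
  3m≤t = m/n*n≤m t 3
  2+m≤n : 2 + m ≤ n
  2+m≤n = ≤-pred (*-cancelʳ-< 3 (2 + m) (suc n) (begin-strict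
    (2 + m) * 3      ≤⟨ +-monoʳ-≤ 6 3m≤t ⟩
    4 + (2 + t)      ≡⟨ cong (4 +_) 2+t≡2n ⟩
    4 + 2 * n        ≤⟨ +-monoˡ-≤ (2 * n) (+-monoˡ-≤ 1 3≤n) ⟩
    n + 1 + 2 * n    ≡⟨ spread n ⟩
    1 + n * 3        <⟨ +-monoˡ-< (n * 3) (s≤s (s≤s z≤n)) ⟩
    suc n * 3        ∎))
    where
    open ≤-Reasoning
    spread : ∀ n → n + 1 + 2 * n ≡ 1 + n * 3
    spread = solve-∀
  sum≡n : m + suc (suc (n ∸ (2 + m))) ≡ n
  sum≡n = trans (trans (+-suc m _) (cong suc (+-suc m _))) (m+[n∸m]≡n 2+m≤n)
  bound : 2 * n + n ≤ 2 * n + (1 + 3 * M)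
  bound = begin
    2 * n + n              ≡⟨ triple n ⟩
    n * 3                  ≡⟨ cong (_* 3) sum≡n ⟨
    (m + suc M) * 3        ≡⟨ *-distribʳ-+ 3 m (suc M) ⟩
    m * 3 + suc M * 3      ≤⟨ +-monoˡ-≤ (suc M * 3) 3m≤t ⟩
    t + suc M * 3          ≡⟨ regroup t M ⟩
    2 + t + (1 + 3 * M)    ≡⟨ cong (_+ (1 + 3 * M)) 2+t≡2n ⟩
    2 * n + (1 + 3 * M)    ∎
    where
    open ≤-Reasoning
    triple : ∀ n → 2 * n + n ≡ n * 3
    triple = solve-∀
    regroup : ∀ t M → t + suc M * 3 ≡ 2 + t + (1 + 3 * M)
    regroup = solve-∀

uncovered-δ₂≤ : ∀ {n} (H : ThreeGraph (suc (suc n))) → ¬ HasCovering K5⁻ H →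
                δ₂ H ≤ (2 * suc (suc n) ∸ 2) / 3
uncovered-δ₂≤ {n} H uncovered with δ₂ H ≤? (2 * suc (suc n) ∸ 2) / 3
... | yes δ₂≤m = δ₂≤m
... | no  δ₂≰m = contradiction (dense-covering H (dense-above-floor {suc (suc n)} (≰⇒> δ₂≰m))) uncovered

theorem4 : ∀ (n : ℕ) → 3 ≤ n → IsC₂ n K5⁻ ((2 * n ∸ 2) / 3)
theorem4 n 3≤n@(s≤s (s≤s (s≤s _))) =
  (extremal , extremal-uncovered zero refl , δ₂-extremal zero (suc zero) refl refl m+M+1≡n) , uncovered-δ₂≤
  where
  split = floor-split n 3≤n
  m+M+1≡n = proj₁ (proj₂ split)
  open Construction (proj₁ split) n (proj₂ (proj₂ split))
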